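{- Let $(G=(V,E),w,c,B)$ be an instance of the Bounded Cost Minimum Diameter Edge Addition problem, let $C\subseteq V$ and $u\in V$. Then the height of a Minimum Height$_B$ SPT of $G$, $C$ and $u$ is at most $D^B_{opt}$.
   Context: Bounded Cost Minimum Diameter Edge Addition: input is an undirected graph $G=(V,E)$, a weight function $w:[V]^2\to\mathbb{N}$, a cost function $c:[V]^2\to\mathbb{N}^*$ (where $[V]^2$ is the set of unordered vertex pairs) and an integer $B$; a $B$-augmentation of $G$ is a graph $(V,E\cup F)$ (with weights $w$) where $F$ is a set of non-edges of $G$ with $\sum_{e\in F}c(e)\le B$. Distances $d_G(u,v)$ are minimum path weights; the diameter is the largest distance; $D^B_{opt}$ is the minimum diameter over all $B$-augmentations of $G$. A Shortest Path Tree of a graph $G'=(V,E')$, a set $C\subseteq V$ and a vertex $u$ is a tree $T$ rooted at $u$, spanning $C$, whose vertices and edges belong to $V$ and $E'$, such that $d_T(u,x)=d_{G'}(u,x)$ for every $x\in C$. The height of a weighted rooted tree is the maximum weight of a path from the root to a leaf. A Minimum Height$_B$ SPT of $G$, $C$ and $u$ is a Shortest Path Tree of $G_B$, $C$ and $u$ of minimum height over all $B$-augmentations $G_B$ of $G$. -}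

module Defs where

open import Data.Nat using (ℕ; zero; suc; _+_; _≤_; _<_)
open import Data.Fin using (Fin) renaming (_<_ to _<ᶠ_)
open import Data.List using (List; []; _∷_; map)
open import Data.Nat.ListAction using (sum)
open import Data.List.Relation.Unary.All using (All)
open import Data.List.Relation.Unary.Unique.Propositional using (Unique)
open import Data.List.Membership.Propositional using (_∈_)
open import Data.Product using (Σ; ∃; ∃-syntax; _×_; _,_)
open import Data.Sum using (_⊎_)
open import Relation.Nullary using (¬_)
open import Relation.Binary.PropositionalEquality using (_≡_; _≢_)

EdgeRel : ℕ → Set₁
EdgeRel n = Fin n → Fin n → Set

-- G is a simple undirected graph (symmetric, irreflexive edge relation);
-- w, c are functions on unordered pairs (symmetric functions), c takes values in ℕ*.
record Instance (n : ℕ) : Set₁ where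
  field
    E        : EdgeRel n
    E-sym    : ∀ {x y} → E x y → E y x
    E-irrefl : ∀ {x} → ¬ E x x
    w        : Fin n → Fin n → ℕ
    w-sym    : ∀ x y → w x y ≡ w y x
    c        : Fin n → Fin n → ℕ
    c-sym    : ∀ x y → c x y ≡ c y x
    c-pos    : ∀ x y → 1 ≤ c x y
    B        : ℕ

module _ {n : ℕ} where

  data Walk (E : EdgeRel n) : Fin n → Fin n → Set where
    []  : ∀ {x} → Walk E x x
    _∷_ : ∀ {x y z} → E x y → Walk E y z → Walk E x z

  verts : ∀ {E x y} → Walk E x y → List (Fin n)
  verts {x = x} []      = x ∷ []
  verts {x = x} (_ ∷ p) = x ∷ verts p

  weight : ∀ {E x y} → (Fin n → Fin n → ℕ) → Walk E x y → ℕ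
  weight w []                  = 0
  weight w (_∷_ {x} {y} _ p)   = w x y + weight w p

  IsPath : ∀ {E x y} → Walk E x y → Set
  IsPath p = Unique (verts p)

  IsDist : EdgeRel n → (Fin n → Fin n → ℕ) → Fin n → Fin n → ℕ → Set
  IsDist E w x y d =
    (Σ (Walk E x y) λ p → IsPath p × weight w p ≡ d) ×
    (∀ (p : Walk E x y) → IsPath p → d ≤ weight w p)

  IsDiam : EdgeRel n → (Fin n → Fin n → ℕ) → ℕ → Set
  IsDiam E w D =
    (∀ x y → ∃[ d ] (IsDist E w x y d × d ≤ D)) ×
    (∃[ x ] ∃[ y ] IsDist E w x y D)

  -- B-augmentations: F is a set of unordered non-edges of G, each pair {i,j}
  -- represented once as (i , j) with i < j, of total cost at most B.
  IsAug : Instance n → List (Fin n × Fin n) → Set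
  IsAug I F =
    All (λ { (i , j) → (i <ᶠ j) × ¬ Instance.E I i j }) F ×
    Unique F ×
    sum (map (λ { (i , j) → Instance.c I i j }) F) ≤ Instance.B I

  Aug : Instance n → List (Fin n × Fin n) → EdgeRel n
  Aug I F x y = Instance.E I x y ⊎ ((x , y) ∈ F ⊎ (y , x) ∈ F)

  record IsTree (E' : EdgeRel n) (u : Fin n) (VT : Fin n → Set) (ET : EdgeRel n) : Set where
    field
      ET-sym   : ∀ {x y} → ET x y → ET y x
      ET-verts : ∀ {x y} → ET x y → VT x × VT y
      ET-sub   : ∀ {x y} → ET x y → E' x y
      root     : VT u
      connected : ∀ x y → VT x → VT y → Σ (Walk ET x y) IsPath
      acyclic  : ∀ x y → (p q : Walk ET x y) → IsPath p → IsPath q → verts p ≡ verts q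

  -- Leaves of a rooted tree: vertices without children (the root is a leaf iff it
  -- has no neighbour; any other vertex is a leaf iff its only neighbour is its parent).
  IsLeaf : (u : Fin n) (VT : Fin n → Set) (ET : EdgeRel n) → Fin n → Set
  IsLeaf u VT ET x =
    VT x ×
    (x ≡ u → ∀ y → ¬ ET x y) ×
    (x ≢ u → ∀ y z → ET x y → ET x z → y ≡ z)

  IsHeight : (Fin n → Fin n → ℕ) → (u : Fin n) (VT : Fin n → Set) (ET : EdgeRel n) → ℕ → Set
  IsHeight w u VT ET h =
    (∃[ x ] (IsLeaf u VT ET x × IsDist ET w u x h)) ×
    (∀ x d → IsLeaf u VT ET x → IsDist ET w u x d → d ≤ h)

  IsSPT : EdgeRel n → (Fin n → Fin n → ℕ) → (C : Fin n → Set) (u : Fin n)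
          (VT : Fin n → Set) (ET : EdgeRel n) → Set
  IsSPT E' w C u VT ET =
    IsTree E' u VT ET ×
    (∀ x → C x → VT x) ×
    (∀ x → C x → ∃[ d ] (IsDist ET w u x d × IsDist E' w u x d))

  IsMinHeightSPT : Instance n → (C : Fin n → Set) (u : Fin n)
                   (VT : Fin n → Set) (ET : EdgeRel n) → Set₁
  IsMinHeightSPT I C u VT ET =
    (∃[ F ] (IsAug I F × IsSPT (Aug I F) (Instance.w I) C u VT ET)) ×
    (∀ F (VT' : Fin n → Set) (ET' : EdgeRel n) → IsAug I F →
       IsSPT (Aug I F) (Instance.w I) C u VT' ET' →
       ∀ h h' → IsHeight (Instance.w I) u VT ET h → IsHeight (Instance.w I) u VT' ET' h' →
       h ≤ h')

  IsOptDiam : Instance n → ℕ → Set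
  IsOptDiam I D =
    (∃[ F ] (IsAug I F × IsDiam (Aug I F) (Instance.w I) D)) ×
    (∀ F D' → IsAug I F → IsDiam (Aug I F) (Instance.w I) D' → D ≤ D')

-- Take a B-augmentation G_F of diameter D^B_opt. Every vertex lies at distance at most
-- D^B_opt from u in G_F, and the "tight" edges (those on some shortest path from u) contain
-- a spanning tree rooted at u, which is therefore a shortest path tree of G_F for every C.
-- The tree is grown along tight walks, giving each new vertex a rank above its parent's;
-- ranks rather than distances make it acyclic, since edge weights may be zero.
-- Its height is the distance of its deepest leaf, hence at most D^B_opt, and a Minimum
-- Height_B SPT is no higher than it.
module Submission where

open import Defs
open import Data.Nat using (ℕ; suc; _+_; _≤_; _<_)
open import Data.Nat.Properties hiding (_≟_)
open import Data.Fin using (Fin; _≟_)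
open import Data.List using (List; []; _∷_; _∷ʳ_; reverse; allFin)
open import Data.List.Properties using (unfold-reverse; reverse-involutive)
open import Data.List.Membership.Propositional using (_∈_; _∉_)
open import Data.List.Membership.Propositional.Properties using (∈-allFin)
open import Data.List.Relation.Binary.Subset.Propositional using (_⊆_)
open import Data.List.Relation.Unary.All using ([]; _∷_; lookup)
open import Data.List.Relation.Unary.All.Properties using (All¬⇒¬Any; ¬Any⇒All¬)
open import Data.List.Relation.Unary.Any using (here; there)
open import Data.List.Relation.Unary.AllPairs using ([]; _∷_)
open import Data.List.Relation.Unary.Unique.Propositional using (Unique)
open import Data.Product using (Σ; _×_; _,_; proj₁; proj₂)
open import Data.Product.Relation.Binary.Lex.NonStrict using (×-totalOrder)
open import Data.Sum using (_⊎_; inj₁; inj₂)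
open import Data.Unit using (⊤; tt)
open import Data.Vec.Functional using (updateAt)
open import Data.Vec.Functional.Properties using (updateAt-updates; updateAt-minimal)
open import Relation.Nullary using (¬_; yes; no; contradiction)
open import Relation.Binary.PropositionalEquality
open import Relation.Binary.PropositionalEquality.Properties using (setoid)

module _ {n : ℕ} {E : EdgeRel n} where

  open import Data.List.Membership.DecPropositional (_≟_ {n}) using (_∈?_)

  infixr 5 _++ʷ_

  _++ʷ_ : ∀ {x y z} → Walk E x y → Walk E y z → Walk E x z
  []      ++ʷ q = q
  (e ∷ p) ++ʷ q = e ∷ (p ++ʷ q)

  weight-++ʷ : ∀ (w : Fin n → Fin n → ℕ) {x y z} (p : Walk E x y) (q : Walk E y z) →
               weight w (p ++ʷ q) ≡ weight w p + weight w q
  weight-++ʷ w []                q = refl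
  weight-++ʷ w (_∷_ {x} {y} e p) q =
    trans (cong (w x y +_) (weight-++ʷ w p q)) (sym (+-assoc (w x y) _ _))

  verts-++ʷ-∷ : ∀ {x y z} (p : Walk E x y) (e : E y z) → verts (p ++ʷ e ∷ []) ≡ verts p ∷ʳ z
  verts-++ʷ-∷ []          e = refl
  verts-++ʷ-∷ {x} (_ ∷ p) e = cong (x ∷_) (verts-++ʷ-∷ p e)

  start∈verts : ∀ {x y} (p : Walk E x y) → x ∈ verts p
  start∈verts []      = here refl
  start∈verts (_ ∷ _) = here refl

  end∈verts : ∀ {x y} (p : Walk E x y) → y ∈ verts p
  end∈verts []      = here refl
  end∈verts (_ ∷ p) = there (end∈verts p)

  closed-path-trivial : ∀ {x} (p : Walk E x x) → IsPath p → verts p ≡ x ∷ []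
  closed-path-trivial []      _           = refl
  closed-path-trivial (_ ∷ p) (x∉p ∷ _) = contradiction (end∈verts p) (All¬⇒¬Any x∉p)

  suffix-path : ∀ {x y z} (q : Walk E y z) → IsPath q → x ∈ verts q →
                Σ (Walk E x z) λ r → IsPath r × (∀ w → weight w r ≤ weight w q)
  suffix-path []      q-path (here refl) = [] , q-path , λ _ → ≤-refl
  suffix-path (e ∷ q) q-path (here refl) = e ∷ q , q-path , λ _ → ≤-refl
  suffix-path (_∷_ {y} {y′} _ q) (_ ∷ q-path) (there x∈q) =
    let r , r-path , r≤q = suffix-path q q-path x∈q
    in  r , r-path , λ w → ≤-trans (r≤q w) (m≤n+m _ (w y y′))

  walk⇒path : ∀ {x y} (p : Walk E x y) →
              Σ (Walk E x y) λ q → IsPath q × (∀ w → weight w q ≤ weight w p)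
  walk⇒path [] = [] , [] ∷ [] , λ _ → ≤-refl
  walk⇒path (_∷_ {x} {y} e p) with walk⇒path p
  ... | q , q-path , q≤p with x ∈? verts q
  ...   | yes x∈q = let r , r-path , r≤q = suffix-path q q-path x∈q
                    in  r , r-path , λ w → ≤-trans (r≤q w) (≤-trans (q≤p w) (m≤n+m _ (w x y)))
  ...   | no  x∉q = e ∷ q , ¬Any⇒All¬ _ x∉q ∷ q-path , λ w → +-monoʳ-≤ (w x y) (q≤p w)

  module _ {E′ : EdgeRel n} (f : ∀ {x y} → E x y → E′ x y) where

    mapʷ : ∀ {x y} → Walk E x y → Walk E′ x y
    mapʷ []      = []
    mapʷ (e ∷ p) = f e ∷ mapʷ p

    verts-mapʷ : ∀ {x y} (p : Walk E x y) → verts (mapʷ p) ≡ verts p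
    verts-mapʷ []          = refl
    verts-mapʷ {x} (_ ∷ p) = cong (x ∷_) (verts-mapʷ p)

    weight-mapʷ : ∀ w {x y} (p : Walk E x y) → weight w (mapʷ p) ≡ weight w p
    weight-mapʷ w []                = refl
    weight-mapʷ w (_∷_ {x} {y} _ p) = cong (w x y +_) (weight-mapʷ w p)

  module _ (E-sym : ∀ {x y} → E x y → E y x) where

    open import Data.List.Relation.Binary.Permutation.Setoid.Properties (setoid (Fin n))
      using (Unique-resp-↭; ↭-reverse)
    open import Data.List.Relation.Binary.Permutation.Setoid (setoid (Fin n)) using (↭-sym)

    reverseʷ : ∀ {x y} → Walk E x y → Walk E y x
    reverseʷ []      = []
    reverseʷ (e ∷ p) = reverseʷ p ++ʷ E-sym e ∷ []

    verts-reverseʷ : ∀ {x y} (p : Walk E x y) → verts (reverseʷ p) ≡ reverse (verts p)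
    verts-reverseʷ []          = refl
    verts-reverseʷ {x} (e ∷ p) = begin
      verts (reverseʷ p ++ʷ E-sym e ∷ [])  ≡⟨ verts-++ʷ-∷ (reverseʷ p) (E-sym e) ⟩
      verts (reverseʷ p) ∷ʳ x              ≡⟨ cong (_∷ʳ x) (verts-reverseʷ p) ⟩
      reverse (verts p) ∷ʳ x               ≡⟨ sym (unfold-reverse x (verts p)) ⟩
      reverse (x ∷ verts p)                ∎
      where open ≡-Reasoning

    reverseʷ-path : ∀ {x y} (p : Walk E x y) → IsPath p → IsPath (reverseʷ p)
    reverseʷ-path p p-path =
      subst Unique (sym (verts-reverseʷ p)) (Unique-resp-↭ (↭-sym (↭-reverse (verts p))) p-path)

IsDist-unique : ∀ {n} {E : EdgeRel n} {w a b d₁ d₂} →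
                IsDist E w a b d₁ → IsDist E w a b d₂ → d₁ ≡ d₂
IsDist-unique ((p₁ , p₁-path , w₁) , min₁) ((p₂ , p₂-path , w₂) , min₂) =
  ≤-antisym (subst (_ ≤_) w₂ (min₁ p₂ p₂-path)) (subst (_ ≤_) w₁ (min₂ p₁ p₁-path))

module SpanningArborescence {n : ℕ} (R : EdgeRel n) (u : Fin n) where

  open import Data.List.Membership.DecPropositional (_≟_ {n}) using (_∈?_)

  record Arborescence : Set where
    field
      parent      : Fin n → Fin n
      rank        : Fin n → ℕ
      parent-edge : ∀ x → x ≢ u → R (parent x) x
      rank-parent : ∀ x → x ≢ u → rank (parent x) < rank x

  record PartialArborescence (S : List (Fin n)) : Set where
    field
      parent      : Fin n → Fin n
      rank        : Fin n → ℕ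
      root∈       : u ∈ S
      parent∈     : ∀ {x} → x ∈ S → x ≢ u → parent x ∈ S
      parent-edge : ∀ {x} → x ∈ S → x ≢ u → R (parent x) x
      rank-parent : ∀ {x} → x ∈ S → x ≢ u → rank (parent x) < rank x

  root-only : PartialArborescence (u ∷ [])
  root-only = record
    { parent = λ x → x ; rank = λ _ → 0 ; root∈ = here refl
    ; parent∈ = only-root ; parent-edge = only-root ; rank-parent = only-root }
    where
      only-root : ∀ {X : Set} {x} → x ∈ u ∷ [] → x ≢ u → X
      only-root (here refl) u≢u = contradiction refl u≢u

  extend : ∀ {S a b} → PartialArborescence S → a ∈ S → R a b → b ∉ S →
           PartialArborescence (b ∷ S)
  extend {S} {a} {b} T a∈S ab b∉S = record
    { parent = parent′ ; rank = rank′ ; root∈ = there root∈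
    ; parent∈ = parent∈′ ; parent-edge = parent-edge′ ; rank-parent = rank-parent′ }
    where
      open PartialArborescence T
      parent′ : Fin n → Fin n
      parent′ = updateAt parent b (λ _ → a)

      rank′ : Fin n → ℕ
      rank′ = updateAt rank b (λ _ → suc (rank a))

      ≢b : ∀ {x} → x ∈ S → x ≢ b
      ≢b x∈S refl = b∉S x∈S

      parent′-old : ∀ {x} → x ∈ S → parent′ x ≡ parent x
      parent′-old x∈S = updateAt-minimal _ b parent (≢b x∈S)

      rank′-old : ∀ {x} → x ∈ S → rank′ x ≡ rank x
      rank′-old x∈S = updateAt-minimal _ b rank (≢b x∈S)

      parent∈′ : ∀ {x} → x ∈ b ∷ S → x ≢ u → parent′ x ∈ b ∷ S
      parent∈′ (here refl) _ = there (subst (_∈ S) (sym (updateAt-updates b parent)) a∈S)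
      parent∈′ (there x∈S) x≢u =
        there (subst (_∈ S) (sym (parent′-old x∈S)) (parent∈ x∈S x≢u))

      parent-edge′ : ∀ {x} → x ∈ b ∷ S → x ≢ u → R (parent′ x) x
      parent-edge′ (here refl) _ = subst (λ p → R p b) (sym (updateAt-updates b parent)) ab
      parent-edge′ (there x∈S) x≢u =
        subst (λ p → R p _) (sym (parent′-old x∈S)) (parent-edge x∈S x≢u)

      rank-parent′ : ∀ {x} → x ∈ b ∷ S → x ≢ u → rank′ (parent′ x) < rank′ x
      rank-parent′ (here refl) _ rewrite updateAt-updates b {λ _ → a} parent =
        subst₂ _<_ (sym (rank′-old a∈S)) (sym (updateAt-updates b rank)) (n<1+n (rank a))
      rank-parent′ (there x∈S) x≢u rewrite parent′-old x∈S =
        subst₂ _<_ (sym (rank′-old (parent∈ x∈S x≢u))) (sym (rank′-old x∈S))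
               (rank-parent x∈S x≢u)

  grow : ∀ {S a x} → PartialArborescence S → a ∈ S → Walk R a x →
         Σ (List (Fin n)) λ S′ → PartialArborescence S′ × x ∈ S′ × S ⊆ S′
  grow T a∈S [] = _ , T , a∈S , λ y∈S → y∈S
  grow {S} T a∈S (_∷_ {y = b} ab p) with b ∈? S
  ... | yes b∈S = grow T b∈S p
  ... | no  b∉S =
    let S′ , T′ , x∈S′ , b∷S⊆S′ = grow (extend T a∈S ab b∉S) (here refl) p
    in  S′ , T′ , x∈S′ , λ y∈S → b∷S⊆S′ (there y∈S)

  covering : (∀ x → Walk R u x) → (L : List (Fin n)) →
             Σ (List (Fin n)) λ S → PartialArborescence S × L ⊆ S
  covering reach []      = u ∷ [] , root-only , λ ()
  covering reach (x ∷ L) =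
    let S , T , L⊆S = covering reach L
        S′ , T′ , x∈S′ , S⊆S′ = grow T (PartialArborescence.root∈ T) (reach x)
        x∷L⊆S′ : x ∷ L ⊆ S′
        x∷L⊆S′ = λ { (here refl) → x∈S′ ; (there y∈L) → S⊆S′ (L⊆S y∈L) }
    in  S′ , T′ , x∷L⊆S′

  reachable⇒arborescence : (∀ x → Walk R u x) → Arborescence
  reachable⇒arborescence reach =
    let _ , T , V⊆S = covering reach (allFin n)
        open PartialArborescence T
    in  record
      { parent = parent ; rank = rank
      ; parent-edge = λ x → parent-edge (V⊆S (∈-allFin x))
      ; rank-parent = λ x → rank-parent (V⊆S (∈-allFin x)) }

module ParentTree {n : ℕ} (u : Fin n) (parent : Fin n → Fin n) (rank : Fin n → ℕ)
                  (rank-parent : ∀ x → x ≢ u → rank (parent x) < rank x) where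

  TreeEdge : EdgeRel n
  TreeEdge x y = (x ≢ u × parent x ≡ y) ⊎ (y ≢ u × parent y ≡ x)

  TreeEdge-sym : ∀ {x y} → TreeEdge x y → TreeEdge y x
  TreeEdge-sym (inj₁ e) = inj₂ e
  TreeEdge-sym (inj₂ e) = inj₁ e

  parent-induction : (P : Fin n → Set) → P u → (∀ x → x ≢ u → P (parent x) → P x) → ∀ x → P x
  parent-induction P P-root P-step x = go (suc (rank x)) x (n<1+n (rank x))
    where
      go : ∀ k x → rank x < k → P x
      go (suc k) x rank<k with x ≟ u
      ... | yes refl = P-root
      ... | no  x≢u  =
        P-step x x≢u (go k (parent x) (<-≤-trans (rank-parent x x≢u) (≤-pred rank<k)))

  walk-to-root : ∀ x → Walk TreeEdge x u
  walk-to-root = parent-induction (λ x → Walk TreeEdge x u) [] λ _ x≢u p → inj₁ (x≢u , refl) ∷ p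

  walk-from-root : ∀ x → Walk TreeEdge u x
  walk-from-root = parent-induction (Walk TreeEdge u) [] λ _ x≢u p → p ++ʷ inj₂ (x≢u , refl) ∷ []

  -- A path that never visits the parent of its start can only move down the tree.
  avoids-parent⇒rank≤ : ∀ {c y} (p : Walk TreeEdge c y) → Unique (parent c ∷ verts p) →
                        rank c ≤ rank y
  avoids-parent⇒rank≤ [] _ = ≤-refl
  avoids-parent⇒rank≤ (inj₁ (_ , refl) ∷ p) (parent∉p ∷ _) =
    contradiction (there (start∈verts p)) (All¬⇒¬Any parent∉p)
  avoids-parent⇒rank≤ (_∷_ {y = z} (inj₂ (z≢u , refl)) p) (_ ∷ p-path) =
    ≤-trans (<⇒≤ (rank-parent z z≢u)) (avoids-parent⇒rank≤ p p-path)

  path-starts-upward : ∀ {x y} (p : Walk TreeEdge x y) → IsPath p → rank y ≤ rank x → x ≢ y →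
                       x ≢ u × Σ (Walk TreeEdge (parent x) y) λ p′ →
                         verts p ≡ x ∷ verts p′ × IsPath p′
  path-starts-upward [] _ _ x≢x = contradiction refl x≢x
  path-starts-upward (inj₁ (x≢u , refl) ∷ p′) (_ ∷ p′-path) _ _ = x≢u , p′ , refl , p′-path
  path-starts-upward (_∷_ {y = z} (inj₂ (z≢u , refl)) p′) p-path ry≤rx _ =
    contradiction ry≤rx (<⇒≱ (<-≤-trans (rank-parent z z≢u) (avoids-parent⇒rank≤ p′ p-path)))

  private
    rev : ∀ {x y} → Walk TreeEdge x y → Walk TreeEdge y x
    rev = reverseʷ TreeEdge-sym

    rev-path : ∀ {x y} (p : Walk TreeEdge x y) → IsPath p → IsPath (rev p)
    rev-path = reverseʷ-path TreeEdge-sym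

  path-ends-downward : ∀ {x y} (p : Walk TreeEdge x y) → IsPath p → rank x ≤ rank y → x ≢ y →
                       y ≢ u × Σ (Walk TreeEdge x (parent y)) λ p′ →
                         verts p ≡ verts p′ ∷ʳ y × IsPath p′
  path-ends-downward {x} {y} p p-path rx≤ry x≢y
    with path-starts-upward (rev p) (rev-path p p-path) rx≤ry (λ y≡x → x≢y (sym y≡x))
  ... | y≢u , q , rev-p≡y∷q , q-path = y≢u , rev q , p≡q∷y , rev-path q q-path
    where
      open ≡-Reasoning
      p≡q∷y : verts p ≡ verts (rev q) ∷ʳ y
      p≡q∷y = begin
        verts p                      ≡⟨ sym (reverse-involutive (verts p)) ⟩
        reverse (reverse (verts p))  ≡⟨ cong reverse (sym (verts-reverseʷ TreeEdge-sym p)) ⟩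
        reverse (verts (rev p))      ≡⟨ cong reverse rev-p≡y∷q ⟩
        reverse (y ∷ verts q)        ≡⟨ unfold-reverse y (verts q) ⟩
        reverse (verts q) ∷ʳ y       ≡⟨ cong (_∷ʳ y) (sym (verts-reverseʷ TreeEdge-sym q)) ⟩
        verts (rev q) ∷ʳ y           ∎

  paths-unique : ∀ {x y} (p q : Walk TreeEdge x y) → IsPath p → IsPath q → verts p ≡ verts q
  paths-unique {x} {y} = go (suc (rank x + rank y)) (n<1+n _)
    where
      go : ∀ k {x y} → rank x + rank y < k →
           (p q : Walk TreeEdge x y) → IsPath p → IsPath q → verts p ≡ verts q
      go (suc k) {x} {y} r<k p q p-path q-path with x ≟ y | ≤-total (rank y) (rank x)
      ... | yes refl | _ =
        trans (closed-path-trivial p p-path) (sym (closed-path-trivial q q-path))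
      ... | no x≢y | inj₁ ry≤rx
        with path-starts-upward p p-path ry≤rx x≢y | path-starts-upward q q-path ry≤rx x≢y
      ...   | x≢u , p′ , p≡ , p′-path | _ , q′ , q≡ , q′-path =
        trans p≡ (trans (cong (x ∷_) (go k smaller p′ q′ p′-path q′-path)) (sym q≡))
        where
          smaller : rank (parent x) + rank y < k
          smaller = <-≤-trans (+-monoˡ-< (rank y) (rank-parent x x≢u)) (≤-pred r<k)
      go (suc k) {x} {y} r<k p q p-path q-path | no x≢y | inj₂ rx≤ry
        with path-ends-downward p p-path rx≤ry x≢y | path-ends-downward q q-path rx≤ry x≢y
      ...   | y≢u , p′ , p≡ , p′-path | _ , q′ , q≡ , q′-path =
        trans p≡ (trans (cong (_∷ʳ y) (go k smaller p′ q′ p′-path q′-path)) (sym q≡))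
        where
          smaller : rank x + rank (parent y) < k
          smaller = <-≤-trans (+-monoʳ-< (rank x) (rank-parent y y≢u)) (≤-pred r<k)

  isTree : ∀ {E′ : EdgeRel n} → (∀ {x y} → TreeEdge x y → E′ x y) → IsTree E′ u (λ _ → ⊤) TreeEdge
  isTree TreeEdge⊆E′ = record
    { ET-sym    = TreeEdge-sym
    ; ET-verts  = λ _ → tt , tt
    ; ET-sub    = TreeEdge⊆E′
    ; root      = tt
    ; connected = λ x y _ _ →
        let p , p-path , _ = walk⇒path (walk-to-root x ++ʷ walk-from-root y) in p , p-path
    ; acyclic   = λ _ _ p q p-path q-path → paths-unique p q p-path q-path
    }

  childless⇒leaf : ∀ {x} → (∀ y → y ≢ u → parent y ≢ x) → IsLeaf u (λ _ → ⊤) TreeEdge x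
  childless⇒leaf {x} childless =
    tt , at-root , λ _ y z x-y x-z → trans (sym (only-parent x-y)) (only-parent x-z)
    where
      only-parent : ∀ {y} → TreeEdge x y → parent x ≡ y
      only-parent (inj₁ (_ , px≡y))   = px≡y
      only-parent (inj₂ (y≢u , py≡x)) = contradiction py≡x (childless _ y≢u)

      at-root : x ≡ u → ∀ y → ¬ TreeEdge x y
      at-root x≡u _ (inj₁ (x≢u , _))   = x≢u x≡u
      at-root _   y (inj₂ (y≢u , py≡x)) = childless y y≢u py≡x

module Distances {n : ℕ} {A : EdgeRel n} {w : Fin n → Fin n → ℕ} {u : Fin n} {d : Fin n → ℕ}
                 (dist : ∀ x → IsDist A w u x (d x)) where

  d-root : d u ≡ 0
  d-root = n≤0⇒n≡0 (proj₂ (dist u) [] ([] ∷ []))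

  d-triangle : ∀ {b x} (R : Walk A b x) → d x ≤ d b + weight w R
  d-triangle {b} {x} R =
    let Q , _ , Q≡d = proj₁ (dist b)
        P , P-path , P≤ = walk⇒path (Q ++ʷ R)
    in  ≤-trans (proj₂ (dist x) P P-path)
                (≤-trans (P≤ w) (≤-reflexive (trans (weight-++ʷ w Q R) (cong (_+ weight w R) Q≡d))))

  Tight : EdgeRel n
  Tight a b = A a b × d b ≡ d a + w a b

  tighten : ∀ {a x} (R : Walk A a x) → d a + weight w R ≡ d x → Walk Tight a x
  tighten []                       _   = []
  tighten {a} {x} (_∷_ {y = b} ab R) R≡d =
    (ab , db≡) ∷ tighten R (trans (cong (_+ weight w R) db≡) R≡d′)
    where
      R≡d′ : d a + w a b + weight w R ≡ d x
      R≡d′ = trans (+-assoc (d a) (w a b) (weight w R)) R≡d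

      db≡ : d b ≡ d a + w a b
      db≡ = ≤-antisym
        (≤-trans (d-triangle (ab ∷ [])) (≤-reflexive (cong (d a +_) (+-identityʳ (w a b)))))
        (+-cancelʳ-≤ (weight w R) _ _ (≤-trans (≤-reflexive R≡d′) (d-triangle R)))

  tight-walk : ∀ x → Walk Tight u x
  tight-walk x =
    let P , _ , P≡d = proj₁ (dist x) in tighten P (trans (cong (_+ weight w P) d-root) P≡d)

module ShortestPathTree {n : ℕ} {A : EdgeRel n} (A-sym : ∀ {x y} → A x y → A y x)
                        {w : Fin n → Fin n → ℕ} {u : Fin n} {d : Fin n → ℕ}
                        (dist : ∀ x → IsDist A w u x (d x)) where

  open Distances dist
  open SpanningArborescence Tight u using (Arborescence; reachable⇒arborescence)
  open Arborescence (reachable⇒arborescence tight-walk)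
  open ParentTree u parent rank rank-parent public

  TreeEdge⊆A : ∀ {x y} → TreeEdge x y → A x y
  TreeEdge⊆A (inj₁ (x≢u , refl)) = A-sym (proj₁ (parent-edge _ x≢u))
  TreeEdge⊆A (inj₂ (y≢u , refl)) = proj₁ (parent-edge _ y≢u)

  d-parent : ∀ x → x ≢ u → d x ≡ d (parent x) + w (parent x) x
  d-parent x x≢u = proj₂ (parent-edge x x≢u)

  d-parent≤ : ∀ x → x ≢ u → d (parent x) ≤ d x
  d-parent≤ x x≢u = ≤-trans (m≤m+n _ _) (≤-reflexive (sym (d-parent x x≢u)))

  tree-walk : ∀ x → Σ (Walk TreeEdge u x) λ q → weight w q ≡ d x
  tree-walk = parent-induction _ ([] , sym d-root) λ x x≢u (q , q≡d) →
    let e = inj₂ (x≢u , refl) ∷ [] in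
    q ++ʷ e , (begin
      weight w (q ++ʷ e)                     ≡⟨ weight-++ʷ w q e ⟩
      weight w q + (w (parent x) x + 0)      ≡⟨ cong₂ _+_ q≡d (+-identityʳ _) ⟩
      d (parent x) + w (parent x) x          ≡⟨ sym (d-parent x x≢u) ⟩
      d x                                    ∎)
    where open ≡-Reasoning

  tree-dist : ∀ x → IsDist TreeEdge w u x (d x)
  tree-dist x =
    let q , q≡d = tree-walk x
        p , p-path , p≤q = walk⇒path q
    in  (p , p-path , ≤-antisym (≤-trans (p≤q w) (≤-reflexive q≡d)) (lower-bound p p-path)) ,
        lower-bound
    where
      lower-bound : ∀ p → IsPath p → d x ≤ weight w p
      lower-bound p p-path = subst (d x ≤_) (weight-mapʷ TreeEdge⊆A w p)
        (proj₂ (dist x) (mapʷ TreeEdge⊆A p) (subst Unique (sym (verts-mapʷ TreeEdge⊆A p)) p-path))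

  isSPT : ∀ C → IsSPT A w C u (λ _ → ⊤) TreeEdge
  isSPT C = isTree TreeEdge⊆A , (λ _ _ → tt) , λ x _ → d x , tree-dist x , dist x

  open import Data.List.Extrema (×-totalOrder ≤-decTotalOrder ≤-totalOrder)
    using (argmax; f[xs]≤f[argmax])

  -- Maximising (d, rank) lexicographically yields a deepest vertex that is also a leaf:
  -- a child is at least as far from u and has a larger rank.
  deepest : Fin n
  deepest = argmax (λ x → d x , rank x) u (allFin n)

  below-deepest : ∀ x → (d x ≤ d deepest × d x ≢ d deepest) ⊎
                        (d x ≡ d deepest × rank x ≤ rank deepest)
  below-deepest x =
    lookup (f[xs]≤f[argmax] {f = λ x → d x , rank x} u (allFin n)) (∈-allFin x)

  d≤d-deepest : ∀ x → d x ≤ d deepest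
  d≤d-deepest x with below-deepest x
  ... | inj₁ (dx≤ , _) = dx≤
  ... | inj₂ (dx≡ , _) = ≤-reflexive dx≡

  deepest-childless : ∀ y → y ≢ u → parent y ≢ deepest
  deepest-childless y y≢u py≡ with below-deepest y
  ... | inj₁ (dy≤ , dy≢) =
    dy≢ (≤-antisym dy≤ (subst (λ p → d p ≤ d y) py≡ (d-parent≤ y y≢u)))
  ... | inj₂ (_ , ry≤) = <⇒≱ (subst (λ p → rank p < rank y) py≡ (rank-parent y y≢u)) ry≤

  height : IsHeight w u (λ _ → ⊤) TreeEdge (d deepest)
  height = (deepest , childless⇒leaf deepest-childless , tree-dist deepest) ,
           λ x _ _ x-dist →
             subst (_≤ d deepest) (IsDist-unique (tree-dist x) x-dist) (d≤d-deepest x)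

Aug-sym : ∀ {n} (I : Instance n) F {x y} → Aug I F x y → Aug I F y x
Aug-sym I F (inj₁ e)        = inj₁ (Instance.E-sym I e)
Aug-sym I F (inj₂ (inj₁ m)) = inj₂ (inj₂ m)
Aug-sym I F (inj₂ (inj₂ m)) = inj₂ (inj₁ m)

lemma4 : ∀ {n} (I : Instance n) (C : Fin n → Set) (u : Fin n)
           (VT : Fin n → Set) (ET : EdgeRel n) →
           IsMinHeightSPT I C u VT ET →
           ∀ h D → IsHeight (Instance.w I) u VT ET h → IsOptDiam I D → h ≤ D
lemma4 {n} I C u VT ET (_ , minimal) h D h-height ((F , F-aug , F-diam) , _) =
  ≤-trans (minimal F _ TreeEdge F-aug (isSPT C) h (d deepest) h-height height) (d≤D deepest)
  where
    distance-from-u : ∀ x → Σ ℕ λ d → IsDist (Aug I F) (Instance.w I) u x d × d ≤ D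
    distance-from-u = proj₁ F-diam u

    d : Fin n → ℕ
    d x = proj₁ (distance-from-u x)

    d≤D : ∀ x → d x ≤ D
    d≤D x = proj₂ (proj₂ (distance-from-u x))

    open ShortestPathTree (Aug-sym I F) (λ x → proj₁ (proj₂ (distance-from-u x)))
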